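{- If $G$ is a graph of maximum degree at most $3$, then $\gamma_e(G)\geq \frac{n(G)}{6\log_2(n(G)+2)+4}$, where $n(G)$ is the order of $G$.
   Context: All graphs are finite, simple and undirected. For a graph $G$ and $S\subseteq V(G)$, and vertices $u,v$ with $u\in S$ or $v\in S$, let $\mathrm{dist}_{(G,S)}(u,v)$ be the minimum number of edges of a path $P$ in $G$ between $u$ and $v$ such that $S$ contains exactly one endvertex of $P$ and no internal vertex of $P$ (and $\infty$ if no such path exists; in particular $\mathrm{dist}_{(G,S)}(u,u)=0$ for $u\in S$). For a vertex $u$, let $w_{(G,S)}(u)=\sum_{v\in S}\left(\frac{1}{2}\right)^{\mathrm{dist}_{(G,S)}(u,v)-1}$ with $(1/2)^\infty=0$. The set $S$ is an exponential dominating set of $G$ if $w_{(G,S)}(u)\geq 1$ for every vertex $u$ of $G$. The exponential domination number $\gamma_e(G)$ is the minimum cardinality of an exponential dominating set of $G$. -}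

module Defs where

open import Data.Nat using (ℕ; zero; suc; _≤_)
open import Data.Bool using (Bool; true; false; if_then_else_)
open import Data.Fin using (Fin; zero; suc)
open import Data.Fin.Subset using (Subset; _∈_; _∉_; ∣_∣)
open import Data.Vec using (tabulate; lookup)
open import Data.List using (List; []; _∷_; _++_; length)
open import Data.List.Relation.Unary.All using (All)
open import Data.List.Relation.Unary.Linked using (Linked)
open import Data.List.Relation.Unary.Unique.Propositional using (Unique)
open import Data.Maybe using (Maybe; just; nothing)
open import Data.Product using (Σ; ∃; _×_)
open import Data.Sum using (_⊎_)
open import Relation.Binary.PropositionalEquality using (_≡_)
open import Relation.Nullary using (¬_)
open import Data.Rational as ℚ using (ℚ; 0ℚ; 1ℚ; ½; _+_; _*_)

record Graph (n : ℕ) : Set where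
  field
    adj     : Fin n → Fin n → Bool
    adj-sym : ∀ i j → adj i j ≡ adj j i
    adj-irr : ∀ i → adj i i ≡ false
open Graph public

Adj : ∀ {n} → Graph n → Fin n → Fin n → Set
Adj G i j = adj G i j ≡ true

N : ∀ {n} → Graph n → Fin n → Subset n
N G i = tabulate (adj G i)

degree : ∀ {n} → Graph n → Fin n → ℕ
degree G i = ∣ N G i ∣

MaxDegreeAtMost : ∀ {n} → ℕ → Graph n → Set
MaxDegreeAtMost d G = ∀ i → degree G i ≤ d

-- SPath G S u v k : there is a path P in G between u and v with exactly k edges
-- such that S contains exactly one endvertex of P and no internal vertex of P.
-- (The one-vertex path u has the single endvertex u.)
data SPath {n : ℕ} (G : Graph n) (S : Subset n) : Fin n → Fin n → ℕ → Set where
  trivial : ∀ {u} → u ∈ S → SPath G S u u zero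
  nontriv : ∀ {u v} (mid : List (Fin n)) →
            Linked (Adj G) (u ∷ mid ++ v ∷ []) →
            Unique (u ∷ mid ++ v ∷ []) →
            All (_∉ S) mid →
            ((u ∈ S × v ∉ S) ⊎ (u ∉ S × v ∈ S)) →
            SPath G S u v (suc (length mid))

-- IsDist G S u v d : dist_(G,S)(u,v) = d, with nothing standing for ∞.
IsDist : ∀ {n} → Graph n → Subset n → Fin n → Fin n → Maybe ℕ → Set
IsDist G S u v (just d) = SPath G S u v d × (∀ k → SPath G S u v k → d ≤ k)
IsDist G S u v nothing  = ∀ k → ¬ SPath G S u v k

halfPow : ℕ → ℚ
halfPow zero    = 1ℚ
halfPow (suc k) = ½ * halfPow k

-- (1/2)^(d-1), with (1/2)^∞ = 0 and (1/2)^(-1) = 2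
wt : Maybe ℕ → ℚ
wt nothing        = 0ℚ
wt (just zero)    = 1ℚ + 1ℚ
wt (just (suc k)) = halfPow k

sumFin : ∀ {n} → (Fin n → ℚ) → ℚ
sumFin {zero}  f = 0ℚ
sumFin {suc n} f = f zero + sumFin (λ i → f (suc i))

-- S is an exponential dominating set: for every vertex u,
-- w_(G,S)(u) = Σ_{v ∈ S} (1/2)^(dist_(G,S)(u,v) - 1) ≥ 1,
-- where distv v is dist_(G,S)(u,v) (uniquely determined for v ∈ S).
IsExpDominating : ∀ {n} → Graph n → Subset n → Set
IsExpDominating {n} G S =
  ∀ u → Σ (Fin n → Maybe ℕ) λ distv →
        (∀ v → v ∈ S → IsDist G S u v (distv v)) ×
        (1ℚ ℚ.≤ sumFin (λ v → if lookup S v then wt (distv v) else 0ℚ))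

{-# OPTIONS --safe #-}
-- Choose K with 2^K ≤ n + 2 and n ≤ 2^(K+1), and scale all weights by 2^K.  Each vertex
-- receives weight at least 1 from S, so the total scaled weight is at least n·2^K.  Conversely,
-- a vertex at distance k + 1 from v ∈ S is the far end of a non-backtracking walk of length
-- k + 1 from v, and maximum degree 3 allows at most 3·2^k of these; such a vertex receives
-- 2^(K-k) from v when k < K, and every vertex beyond distance K receives at most 1.  So v
-- sends at most 2^(K+1) + K·3·2^K + n ≤ (3K + 4)·2^K, whence n ≤ (3K + 4)|S| with
-- K ≤ log₂ (n + 2).

module Submission where

open import Defs

open import Data.Bool using (true; false; if_then_else_)
open import Data.Fin using (Fin; zero; suc; toℕ)
open import Data.Fin.Properties using (toℕ<n)
open import Data.Fin.Subset using (Subset; _∈_; _∪_; _-_; ⁅_⁆; ⋃; ∣_∣; inside; outside)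
open import Data.Fin.Subset.Properties
  using (∣p∣≤∣x∷p∣; ∣⊥∣≡0; ∣⁅x⁆∣≡1; x∈p∪q⁺; x∈⁅x⁆; x∈p⇒∣p-x∣<∣p∣; x∈p∧x≢y⇒x∈p-y; p─q⊆p)
import Data.Integer as ℤ
import Data.Integer.Properties as ℤₚ
open import Data.List using (List; []; _∷_; _++_; [_]; map; length; concatMap)
open import Data.List.Properties using (length-map; length-++)
open import Data.List.Membership.Propositional using () renaming (_∈_ to _∈ₗ_)
open import Data.List.Membership.Propositional.Properties using (∈-map⁺; ∈-concatMap⁺)
open import Data.List.Relation.Unary.All as All using (All; []; _∷_)
open import Data.List.Relation.Unary.All.Properties using (map⁺; concat⁺)
open import Data.List.Relation.Unary.AllPairs using (_∷_)
open import Data.List.Relation.Unary.Any as Any using ()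
open import Data.List.Relation.Unary.Linked using (Linked; [-]; _∷_)
open import Data.List.Relation.Unary.Unique.Propositional using (Unique)
open import Data.Maybe using (Maybe; just; nothing)
open import Data.Nat using (ℕ; zero; suc; _≤_; _<_; _^_; _∸_; _*_; _+_; z≤n; s≤s; _≤′_; ≤′-refl; ≤′-step; _<?_)
open import Data.Nat.Coprimality using (1-coprimeTo) renaming (sym to coprime-sym)
open import Data.Nat.Properties
open import Data.Nat.Tactic.RingSolver using (solve-∀)
open import Data.Product using (_×_; _,_; proj₁; proj₂; ∃-syntax)
open import Data.Rational as ℚ using (ℚ; mkℚ; 0ℚ; 1ℚ; ½; *≤*)
import Data.Rational.Properties as ℚₚ
open import Data.Sum using (inj₁; inj₂)
open import Data.Vec using ([]; _∷_; lookup; here; there)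
open import Data.Vec.Properties using (lookup∘tabulate; lookup⇒[]=; []=⇒lookup)
open import Function using (_∘_)
open import Relation.Binary.PropositionalEquality
  using (_≡_; refl; sym; trans; cong; cong₂; subst; module ≡-Reasoning)
open import Relation.Nullary using (yes; no)

open import Algebra.Properties.Semiring.Sum +-*-semiring using (sum; sum-syntax; ∑-comm; ∑-distrib-+)

∑-mono-≤ : ∀ {n} {f g : Fin n → ℕ} → (∀ i → f i ≤ g i) → ∑[ i < n ] f i ≤ ∑[ i < n ] g i
∑-mono-≤ {zero}  f≤g = z≤n
∑-mono-≤ {suc n} f≤g = +-mono-≤ (f≤g zero) (∑-mono-≤ (f≤g ∘ suc))

∑-const : ∀ n c → ∑[ i < n ] c ≡ n * c
∑-const zero    c = refl
∑-const (suc n) c = cong (c +_) (∑-const n c)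

∑-indicator : ∀ {n} (p : Subset n) c → ∑[ i < n ] (if lookup p i then c else 0) ≡ ∣ p ∣ * c
∑-indicator []            c = refl
∑-indicator (inside ∷ p)  c = cong (c +_) (∑-indicator p c)
∑-indicator (outside ∷ p) c = ∑-indicator p c

≤-∑-toℕ : ∀ (f : ℕ → ℕ) {k K} → k < K → f k ≤ ∑[ i < K ] f (toℕ i)
≤-∑-toℕ f {zero}  {suc K} _          = m≤m+n _ _
≤-∑-toℕ f {suc k} {suc K} (s≤s k<K) = ≤-trans (≤-∑-toℕ (f ∘ suc) k<K) (m≤n+m _ _)

∣p∪q∣≤∣p∣+∣q∣ : ∀ {n} (p q : Subset n) → ∣ p ∪ q ∣ ≤ ∣ p ∣ + ∣ q ∣
∣p∪q∣≤∣p∣+∣q∣ []            []            = z≤n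
∣p∪q∣≤∣p∣+∣q∣ (inside ∷ p)  (x ∷ q)       = s≤s (≤-trans (∣p∪q∣≤∣p∣+∣q∣ p q) (+-monoʳ-≤ ∣ p ∣ (∣p∣≤∣x∷p∣ x q)))
∣p∪q∣≤∣p∣+∣q∣ (outside ∷ p) (inside ∷ q)  = subst (suc ∣ p ∪ q ∣ ≤_) (sym (+-suc ∣ p ∣ ∣ q ∣)) (s≤s (∣p∪q∣≤∣p∣+∣q∣ p q))
∣p∪q∣≤∣p∣+∣q∣ (outside ∷ p) (outside ∷ q) = ∣p∪q∣≤∣p∣+∣q∣ p q

elements : ∀ {n} → Subset n → List (Fin n)
elements []            = []
elements (inside ∷ p)  = zero ∷ map suc (elements p)
elements (outside ∷ p) = map suc (elements p)

length-elements : ∀ {n} (p : Subset n) → length (elements p) ≡ ∣ p ∣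
length-elements []            = refl
length-elements (inside ∷ p)  = cong suc (trans (length-map suc (elements p)) (length-elements p))
length-elements (outside ∷ p) = trans (length-map suc (elements p)) (length-elements p)

∈-elements⁺ : ∀ {n} {x : Fin n} {p} → x ∈ p → x ∈ₗ elements p
∈-elements⁺ {p = inside ∷ p}  here       = Any.here refl
∈-elements⁺ {p = inside ∷ p}  (there x∈p) = Any.there (∈-map⁺ suc (∈-elements⁺ x∈p))
∈-elements⁺ {p = outside ∷ p} (there x∈p) = ∈-map⁺ suc (∈-elements⁺ x∈p)

elements⊆ : ∀ {n} (p : Subset n) → All (_∈ p) (elements p)
elements⊆ []            = []
elements⊆ (inside ∷ p)  = here ∷ map⁺ (All.map there (elements⊆ p))
elements⊆ (outside ∷ p) = map⁺ (All.map there (elements⊆ p))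

fromList : ∀ {n} → List (Fin n) → Subset n
fromList xs = ⋃ (map ⁅_⁆ xs)

∣fromList∣≤length : ∀ {n} (xs : List (Fin n)) → ∣ fromList xs ∣ ≤ length xs
∣fromList∣≤length {n} []   = ≤-reflexive (∣⊥∣≡0 n)
∣fromList∣≤length (x ∷ xs) = ≤-trans (∣p∪q∣≤∣p∣+∣q∣ ⁅ x ⁆ (fromList xs))
  (+-mono-≤ (≤-reflexive (∣⁅x⁆∣≡1 x)) (∣fromList∣≤length xs))

∈-fromList⁺ : ∀ {n} {x : Fin n} {xs} → x ∈ₗ xs → x ∈ fromList xs
∈-fromList⁺ (Any.here refl)  = x∈p∪q⁺ (inj₁ (x∈⁅x⁆ _))
∈-fromList⁺ (Any.there x∈xs) = x∈p∪q⁺ (inj₂ (∈-fromList⁺ x∈xs))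

length-concatMap-≤ : ∀ {A B : Set} {f : A → List B} {c xs} →
                     All (λ x → length (f x) ≤ c) xs → length (concatMap f xs) ≤ c * length xs
length-concatMap-≤ []                                  = z≤n
length-concatMap-≤ {f = f} {c} {x ∷ xs} (fx≤c ∷ fxs≤c) = begin
  length (f x ++ concatMap f xs)          ≡⟨ length-++ (f x) ⟩
  length (f x) + length (concatMap f xs)  ≤⟨ +-mono-≤ fx≤c (length-concatMap-≤ fxs≤c) ⟩
  c + c * length xs                       ≡⟨ *-suc c (length xs) ⟨
  c * suc (length xs)                     ∎
  where open ≤-Reasoning

module _ {n} (G : Graph n) where

  Adj⇒∈N : ∀ {x y} → Adj G y x → x ∈ N G y
  Adj⇒∈N {x} {y} y~x = lookup⇒[]= x (N G y) (trans (lookup∘tabulate (adj G y) x) y~x)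

  ∈N⇒Adj : ∀ {x y} → x ∈ N G y → Adj G y x
  ∈N⇒Adj {x} {y} x∈Ny = trans (sym (lookup∘tabulate (adj G y) x)) ([]=⇒lookup x∈Ny)

  ∈N-sym : ∀ {x y} → x ∈ N G y → y ∈ N G x
  ∈N-sym {x} {y} x∈Ny = Adj⇒∈N (trans (adj-sym G x y) (∈N⇒Adj x∈Ny))

  ∣N-x∣≤2 : MaxDegreeAtMost 3 G → ∀ {x y} → y ∈ N G x → ∣ N G x - y ∣ ≤ 2
  ∣N-x∣≤2 Δ≤3 {x} y∈Nx = ≤-pred (≤-trans (x∈p⇒∣p-x∣<∣p∣ y∈Nx) (Δ≤3 x))

fromℕ : ℕ → ℚ
fromℕ m = mkℚ (ℤ.+ m) 0 (coprime-sym (1-coprimeTo m))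

fromℕ-+ : ∀ a b → fromℕ (a + b) ≡ fromℕ a ℚ.+ fromℕ b
fromℕ-+ a b = sym (trans (cong₂ (λ x y → (x ℤ.+ y) ℚ./ 1) (ℤₚ.*-identityʳ (ℤ.+ a)) (ℤₚ.*-identityʳ (ℤ.+ b)))
                         (ℚₚ.normalize-coprime _))

fromℕ-cancel-≤ : ∀ {a b} → fromℕ a ℚ.≤ fromℕ b → a ≤ b
fromℕ-cancel-≤ {a} {b} (*≤* a≤b) rewrite ℤₚ.*-identityʳ (ℤ.+ a) | ℤₚ.*-identityʳ (ℤ.+ b) = ℤₚ.drop‿+≤+ a≤b

fromℕ-double : ∀ a → fromℕ (2 * a) ≡ fromℕ a ℚ.+ fromℕ a
fromℕ-double a = trans (cong (λ b → fromℕ (a + b)) (+-identityʳ a)) (fromℕ-+ a a)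

double-*-½ : ∀ q → (q ℚ.+ q) ℚ.* ½ ≡ q
double-*-½ q = begin
  (q ℚ.+ q) ℚ.* ½        ≡⟨ ℚₚ.*-distribʳ-+ ½ q q ⟩
  q ℚ.* ½ ℚ.+ q ℚ.* ½    ≡⟨ ℚₚ.*-distribˡ-+ q ½ ½ ⟨
  q ℚ.* (½ ℚ.+ ½)        ≡⟨ ℚₚ.*-identityʳ q ⟩
  q                      ∎
  where open ≡-Reasoning

fromℕ-2^-*-halfPow : ∀ m → fromℕ (2 ^ m) ℚ.* halfPow m ≡ 1ℚ
fromℕ-2^-*-halfPow zero    = refl
fromℕ-2^-*-halfPow (suc m) = begin
  fromℕ (2 * 2 ^ m) ℚ.* (½ ℚ.* halfPow m)  ≡⟨ ℚₚ.*-assoc (fromℕ (2 * 2 ^ m)) ½ (halfPow m) ⟨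
  fromℕ (2 * 2 ^ m) ℚ.* ½ ℚ.* halfPow m    ≡⟨ cong (λ q → q ℚ.* ½ ℚ.* halfPow m) (fromℕ-double (2 ^ m)) ⟩
  (x ℚ.+ x) ℚ.* ½ ℚ.* halfPow m            ≡⟨ cong (ℚ._* halfPow m) (double-*-½ x) ⟩
  x ℚ.* halfPow m                          ≡⟨ fromℕ-2^-*-halfPow m ⟩
  1ℚ                                       ∎
  where
  open ≡-Reasoning
  x : ℚ
  x = fromℕ (2 ^ m)

halfPow-+ : ∀ a b → halfPow (a + b) ≡ halfPow a ℚ.* halfPow b
halfPow-+ zero    b = sym (ℚₚ.*-identityˡ (halfPow b))
halfPow-+ (suc a) b = trans (cong (½ ℚ.*_) (halfPow-+ a b)) (sym (ℚₚ.*-assoc ½ (halfPow a) (halfPow b)))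

halfPow-nonNeg : ∀ k → 0ℚ ℚ.≤ halfPow k
halfPow-nonNeg zero    = *≤* (ℤ.+≤+ z≤n)
halfPow-nonNeg (suc k) = ℚₚ.*-monoˡ-≤-nonNeg ½ (halfPow-nonNeg k)

halfPow-suc-≤ : ∀ k → halfPow (suc k) ℚ.≤ halfPow k
halfPow-suc-≤ k = begin
  ½ ℚ.* halfPow k   ≤⟨ ℚₚ.*-monoʳ-≤-nonNeg (halfPow k) {{ℚ.nonNegative (halfPow-nonNeg k)}} ½≤1 ⟩
  1ℚ ℚ.* halfPow k  ≡⟨ ℚₚ.*-identityˡ (halfPow k) ⟩
  halfPow k         ∎
  where
  open ℚₚ.≤-Reasoning
  ½≤1 : ½ ℚ.≤ 1ℚ
  ½≤1 = *≤* (ℤ.+≤+ (s≤s z≤n))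

halfPow-antimono : ∀ {m n} → m ≤ n → halfPow n ℚ.≤ halfPow m
halfPow-antimono = antimono′ ∘ ≤⇒≤′
  where
  antimono′ : ∀ {m n} → m ≤′ n → halfPow n ℚ.≤ halfPow m
  antimono′ ≤′-refl           = ℚₚ.≤-refl
  antimono′ (≤′-step {n} m≤n) = ℚₚ.≤-trans (halfPow-suc-≤ n) (antimono′ m≤n)

0≤fromℕ0* : ∀ h → 0ℚ ℚ.≤ fromℕ 0 ℚ.* h
0≤fromℕ0* h = ℚₚ.≤-reflexive (sym (ℚₚ.*-zeroˡ h))

-- 2^K · wt d, rounded up to 1 when d > K + 1 (where the truncated K ∸ k is 0).
scaledWt : ℕ → Maybe ℕ → ℕ
scaledWt K nothing        = 0
scaledWt K (just zero)    = 2 ^ suc K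
scaledWt K (just (suc k)) = 2 ^ (K ∸ k)

wt≤scaledWt : ∀ K d → wt d ℚ.≤ fromℕ (scaledWt K d) ℚ.* halfPow K
wt≤scaledWt K nothing = 0≤fromℕ0* (halfPow K)
wt≤scaledWt K (just zero) = begin
  1ℚ ℚ.+ 1ℚ                            ≡⟨ cong₂ ℚ._+_ (fromℕ-2^-*-halfPow K) (fromℕ-2^-*-halfPow K) ⟨
  x ℚ.* halfPow K ℚ.+ x ℚ.* halfPow K  ≡⟨ ℚₚ.*-distribʳ-+ (halfPow K) x x ⟨
  (x ℚ.+ x) ℚ.* halfPow K              ≡⟨ cong (ℚ._* halfPow K) (fromℕ-double (2 ^ K)) ⟨
  fromℕ (2 * 2 ^ K) ℚ.* halfPow K      ∎
  where
  open ℚₚ.≤-Reasoning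
  x : ℚ
  x = fromℕ (2 ^ K)
wt≤scaledWt K (just (suc k)) with ≤-total k K
... | inj₁ k≤K = begin
  halfPow k                                    ≡⟨ ℚₚ.*-identityˡ (halfPow k) ⟨
  1ℚ ℚ.* halfPow k                             ≡⟨ cong (ℚ._* halfPow k) (fromℕ-2^-*-halfPow (K ∸ k)) ⟨
  x ℚ.* halfPow (K ∸ k) ℚ.* halfPow k          ≡⟨ ℚₚ.*-assoc x (halfPow (K ∸ k)) (halfPow k) ⟩
  x ℚ.* (halfPow (K ∸ k) ℚ.* halfPow k)        ≡⟨ cong (x ℚ.*_) (halfPow-+ (K ∸ k) k) ⟨
  x ℚ.* halfPow (K ∸ k + k)                    ≡⟨ cong (λ j → x ℚ.* halfPow j) (m∸n+n≡m k≤K) ⟩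
  x ℚ.* halfPow K                              ∎
  where
  open ℚₚ.≤-Reasoning
  x : ℚ
  x = fromℕ (2 ^ (K ∸ k))
... | inj₂ K≤k = begin
  halfPow k                          ≤⟨ halfPow-antimono K≤k ⟩
  halfPow K                          ≡⟨ ℚₚ.*-identityˡ (halfPow K) ⟨
  1ℚ ℚ.* halfPow K                   ≡⟨ cong (λ j → fromℕ (2 ^ j) ℚ.* halfPow K) (m≤n⇒m∸n≡0 K≤k) ⟨
  fromℕ (2 ^ (K ∸ k)) ℚ.* halfPow K  ∎
  where open ℚₚ.≤-Reasoning

sumFin-≤ : ∀ {n} {f : Fin n → ℚ} (g : Fin n → ℕ) h →
           (∀ i → f i ℚ.≤ fromℕ (g i) ℚ.* h) → sumFin f ℚ.≤ fromℕ (∑[ i < n ] g i) ℚ.* h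
sumFin-≤ {zero}  g h _   = 0≤fromℕ0* h
sumFin-≤ {suc n} {f} g h f≤g = begin
  f zero ℚ.+ sumFin (f ∘ suc)                           ≤⟨ ℚₚ.+-mono-≤ (f≤g zero) (sumFin-≤ (g ∘ suc) h (f≤g ∘ suc)) ⟩
  fromℕ (g zero) ℚ.* h ℚ.+ fromℕ (sum (g ∘ suc)) ℚ.* h  ≡⟨ ℚₚ.*-distribʳ-+ h (fromℕ (g zero)) (fromℕ (sum (g ∘ suc))) ⟨
  (fromℕ (g zero) ℚ.+ fromℕ (sum (g ∘ suc))) ℚ.* h     ≡⟨ cong (ℚ._* h) (fromℕ-+ (g zero) (sum (g ∘ suc))) ⟨
  fromℕ (g zero + sum (g ∘ suc)) ℚ.* h                 ∎
  where open ℚₚ.≤-Reasoning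

1≤scaled⇒2^≤ : ∀ K M → 1ℚ ℚ.≤ fromℕ M ℚ.* halfPow K → 2 ^ K ≤ M
1≤scaled⇒2^≤ K M 1≤M/2^K = fromℕ-cancel-≤ (begin
  x                                  ≡⟨ ℚₚ.*-identityʳ x ⟨
  x ℚ.* 1ℚ                           ≤⟨ ℚₚ.*-monoˡ-≤-nonNeg x 1≤M/2^K ⟩
  x ℚ.* (fromℕ M ℚ.* halfPow K)      ≡⟨ cong (x ℚ.*_) (ℚₚ.*-comm (fromℕ M) (halfPow K)) ⟩
  x ℚ.* (halfPow K ℚ.* fromℕ M)      ≡⟨ ℚₚ.*-assoc x (halfPow K) (fromℕ M) ⟨
  x ℚ.* halfPow K ℚ.* fromℕ M        ≡⟨ cong (ℚ._* fromℕ M) (fromℕ-2^-*-halfPow K) ⟩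
  1ℚ ℚ.* fromℕ M                     ≡⟨ ℚₚ.*-identityˡ (fromℕ M) ⟩
  fromℕ M                            ∎)
  where
  open ℚₚ.≤-Reasoning
  x : ℚ
  x = fromℕ (2 ^ K)

2^≤∑scaledWt : ∀ {n} (S : Subset n) (D : Fin n → Maybe ℕ) K →
               1ℚ ℚ.≤ sumFin (λ v → if lookup S v then wt (D v) else 0ℚ) →
               2 ^ K ≤ ∑[ v < n ] (if lookup S v then scaledWt K (D v) else 0)
2^≤∑scaledWt S D K 1≤w = 1≤scaled⇒2^≤ K _ (ℚₚ.≤-trans 1≤w (sumFin-≤ _ (halfPow K) term≤))
  where
  term≤ : ∀ v → (if lookup S v then wt (D v) else 0ℚ) ℚ.≤
                fromℕ (if lookup S v then scaledWt K (D v) else 0) ℚ.* halfPow K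
  term≤ v with lookup S v
  ... | true  = wt≤scaledWt K (D v)
  ... | false = 0≤fromℕ0* (halfPow K)

module Frontier {n} (G : Graph n) (v : Fin n) where

  -- (x , y) ∈ frontier k when some non-backtracking walk of length k + 1 from v ends with the
  -- step y → x; the continuations of (y , z) are the steps out of y other than back to z.
  continuations : Fin n × Fin n → List (Fin n × Fin n)
  continuations (y , z) = map (_, y) (elements (N G y - z))

  frontier : ℕ → List (Fin n × Fin n)
  frontier zero    = map (_, v) (elements (N G v))
  frontier (suc k) = concatMap continuations (frontier k)

  Edge : Fin n × Fin n → Set
  Edge (x , y) = y ∈ N G x

  frontier-edges : ∀ k → All Edge (frontier k)
  frontier-edges zero    = map⁺ (All.map (∈N-sym G) (elements⊆ (N G v)))
  frontier-edges (suc k) = concat⁺ (map⁺ (All.universal continuation-edges (frontier k)))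
    where
    continuation-edges : ∀ e → All Edge (continuations e)
    continuation-edges (y , z) = map⁺ (All.map (∈N-sym G ∘ p─q⊆p (N G y) ⁅ z ⁆) (elements⊆ (N G y - z)))

  length-frontier : MaxDegreeAtMost 3 G → ∀ k → length (frontier k) ≤ 2 ^ k * 3
  length-frontier Δ≤3 zero = begin
    length (map (_, v) (elements (N G v)))  ≡⟨ length-map (_, v) (elements (N G v)) ⟩
    length (elements (N G v))               ≡⟨ length-elements (N G v) ⟩
    ∣ N G v ∣                               ≤⟨ Δ≤3 v ⟩
    3                                       ∎
    where open ≤-Reasoning
  length-frontier Δ≤3 (suc k) = begin
    length (concatMap continuations (frontier k))  ≤⟨ length-concatMap-≤ (All.map length-continuations (frontier-edges k)) ⟩
    2 * length (frontier k)                        ≤⟨ *-monoʳ-≤ 2 (length-frontier Δ≤3 k) ⟩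
    2 * (2 ^ k * 3)                                ≡⟨ *-assoc 2 (2 ^ k) 3 ⟨
    2 ^ suc k * 3                                  ∎
    where
    open ≤-Reasoning
    length-continuations : ∀ {e} → Edge e → length (continuations e) ≤ 2
    length-continuations {y , z} z∈Ny = begin
      length (continuations (y , z))  ≡⟨ length-map (_, y) (elements (N G y - z)) ⟩
      length (elements (N G y - z))   ≡⟨ length-elements (N G y - z) ⟩
      ∣ N G y - z ∣                   ≤⟨ ∣N-x∣≤2 G Δ≤3 z∈Ny ⟩
      2                               ∎

  next : List (Fin n) → Fin n
  next []      = v
  next (x ∷ _) = x

  All-next : ∀ {P : Fin n → Set} mid → All P (mid ++ [ v ]) → P (next mid)
  All-next []      (p ∷ _) = p
  All-next (_ ∷ _) (p ∷ _) = p

  path-in-frontier : ∀ u mid → Linked (Adj G) (u ∷ mid ++ [ v ]) → Unique (u ∷ mid ++ [ v ]) →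
                     (u , next mid) ∈ₗ frontier (length mid)
  path-in-frontier u []        (u~v ∷ [-])  _ = ∈-map⁺ (_, v) (∈-elements⁺ (∈N-sym G (Adj⇒∈N G u~v)))
  path-in-frontier u (w ∷ mid) (u~w ∷ walk) ((_ ∷ u∉rest) ∷ unique) =
    ∈-concatMap⁺ continuations (Any.map (λ { refl → ∈-map⁺ (_, w) (∈-elements⁺ u∈Nw-next) })
                          (path-in-frontier w mid walk unique))
    where
    u∈Nw-next : u ∈ N G w - next mid
    u∈Nw-next = x∈p∧x≢y⇒x∈p-y (∈N-sym G (Adj⇒∈N G u~w)) (All-next mid u∉rest)

  reached : ℕ → Subset n
  reached k = fromList (map proj₁ (frontier k))

  ∣reached∣≤ : MaxDegreeAtMost 3 G → ∀ k → ∣ reached k ∣ ≤ 2 ^ k * 3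
  ∣reached∣≤ Δ≤3 k = ≤-trans (∣fromList∣≤length (map proj₁ (frontier k)))
    (≤-trans (≤-reflexive (length-map proj₁ (frontier k))) (length-frontier Δ≤3 k))

  SPath⇒reached : ∀ {S u k} → SPath G S u v (suc k) → u ∈ reached k
  SPath⇒reached (nontriv mid walk unique _ _) = ∈-fromList⁺ (∈-map⁺ proj₁ (path-in-frontier _ mid walk unique))

  SPath⇒≡ : ∀ {S u} → SPath G S u v 0 → u ≡ v
  SPath⇒≡ (trivial _) = refl

  levelWeight : ℕ → Fin n → ℕ
  levelWeight K u = (if lookup ⁅ v ⁆ u then 2 ^ suc K else 0)
                  + ∑[ i < K ] (if lookup (reached (toℕ i)) u then 2 ^ (K ∸ toℕ i) else 0)
                  + 1

  scaledWt≤levelWeight : ∀ {S u} K d → IsDist G S u v d → scaledWt K d ≤ levelWeight K u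
  scaledWt≤levelWeight K nothing _ = z≤n
  scaledWt≤levelWeight K (just zero) (path , _) with refl ← SPath⇒≡ path
    rewrite []=⇒lookup (x∈⁅x⁆ v) = ≤-trans (m≤m+n _ _) (m≤m+n _ 1)
  scaledWt≤levelWeight {u = u} K (just (suc k)) (path , _) with k <? K
  ... | yes k<K = begin
    2 ^ (K ∸ k)               ≡⟨ level-k ⟨
    level k                   ≤⟨ ≤-∑-toℕ level k<K ⟩
    ∑[ i < K ] level (toℕ i)  ≤⟨ ≤-trans (m≤n+m _ _) (m≤m+n _ 1) ⟩
    levelWeight K u           ∎
    where
    open ≤-Reasoning
    level : ℕ → ℕ
    level j = if lookup (reached j) u then 2 ^ (K ∸ j) else 0
    level-k : level k ≡ 2 ^ (K ∸ k)
    level-k rewrite []=⇒lookup (SPath⇒reached path) = refl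
  ... | no k≮K rewrite m≤n⇒m∸n≡0 (≮⇒≥ k≮K) = m≤n+m 1 _

  ∑-levelWeight : MaxDegreeAtMost 3 G → ∀ K → ∑[ u < n ] levelWeight K u ≤ 2 ^ suc K + K * (2 ^ K * 3) + n
  ∑-levelWeight Δ≤3 K = begin
    ∑[ u < n ] (A u + B u + 1)                   ≡⟨ ∑-distrib-+ (λ u → A u + B u) (λ _ → 1) ⟩
    ∑[ u < n ] (A u + B u) + ∑[ u < n ] 1        ≡⟨ cong₂ _+_ (∑-distrib-+ A B) (trans (∑-const n 1) (*-identityʳ n)) ⟩
    ∑[ u < n ] A u + ∑[ u < n ] B u + n          ≡⟨ cong (λ a → a + ∑[ u < n ] B u + n) ∑A ⟩
    2 ^ suc K + ∑[ u < n ] B u + n               ≡⟨ cong (λ b → 2 ^ suc K + b + n) (∑-comm (λ u i → C i u)) ⟩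
    2 ^ suc K + ∑[ i < K ] ∑[ u < n ] C i u + n  ≤⟨ +-monoˡ-≤ n (+-monoʳ-≤ (2 ^ suc K) (∑-mono-≤ level-bound)) ⟩
    2 ^ suc K + ∑[ i < K ] (2 ^ K * 3) + n       ≡⟨ cong (λ b → 2 ^ suc K + b + n) (∑-const K (2 ^ K * 3)) ⟩
    2 ^ suc K + K * (2 ^ K * 3) + n              ∎
    where
    open ≤-Reasoning
    A : Fin n → ℕ
    A u = if lookup ⁅ v ⁆ u then 2 ^ suc K else 0
    C : Fin K → Fin n → ℕ
    C i u = if lookup (reached (toℕ i)) u then 2 ^ (K ∸ toℕ i) else 0
    B : Fin n → ℕ
    B u = ∑[ i < K ] C i u
    ∑A : ∑[ u < n ] A u ≡ 2 ^ suc K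
    ∑A = trans (∑-indicator ⁅ v ⁆ (2 ^ suc K)) (trans (cong (_* 2 ^ suc K) (∣⁅x⁆∣≡1 v)) (*-identityˡ (2 ^ suc K)))
    level-bound : ∀ i → ∑[ u < n ] C i u ≤ 2 ^ K * 3
    level-bound i = begin
      ∑[ u < n ] C i u                  ≡⟨ ∑-indicator (reached k) (2 ^ (K ∸ k)) ⟩
      ∣ reached k ∣ * 2 ^ (K ∸ k)       ≤⟨ *-monoˡ-≤ (2 ^ (K ∸ k)) (∣reached∣≤ Δ≤3 k) ⟩
      2 ^ k * 3 * 2 ^ (K ∸ k)           ≡⟨ *-assoc (2 ^ k) 3 (2 ^ (K ∸ k)) ⟩
      2 ^ k * (3 * 2 ^ (K ∸ k))         ≡⟨ cong (2 ^ k *_) (*-comm 3 (2 ^ (K ∸ k))) ⟩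
      2 ^ k * (2 ^ (K ∸ k) * 3)         ≡⟨ *-assoc (2 ^ k) (2 ^ (K ∸ k)) 3 ⟨
      2 ^ k * 2 ^ (K ∸ k) * 3           ≡⟨ cong (_* 3) (^-distribˡ-+-* 2 k (K ∸ k)) ⟨
      2 ^ (k + (K ∸ k)) * 3             ≡⟨ cong (λ j → 2 ^ j * 3) (m+[n∸m]≡n (<⇒≤ (toℕ<n i))) ⟩
      2 ^ K * 3                         ∎
      where
      k : ℕ
      k = toℕ i

double-count : ∀ {n} (G : Graph n) → MaxDegreeAtMost 3 G → (S : Subset n) → IsExpDominating G S →
               ∀ K → n * 2 ^ K ≤ ∣ S ∣ * (2 ^ suc K + K * (2 ^ K * 3) + n)
double-count {n} G Δ≤3 S dom K = begin
  n * 2 ^ K                                 ≡⟨ ∑-const n (2 ^ K) ⟨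
  ∑[ u < n ] (2 ^ K)                        ≤⟨ ∑-mono-≤ received ⟩
  ∑[ u < n ] ∑[ v < n ] W u v               ≡⟨ ∑-comm W ⟩
  ∑[ v < n ] ∑[ u < n ] W u v               ≤⟨ ∑-mono-≤ sent-from ⟩
  ∑[ v < n ] (if lookup S v then B else 0)  ≡⟨ ∑-indicator S B ⟩
  ∣ S ∣ * B                                 ∎
  where
  open ≤-Reasoning
  D : Fin n → Fin n → Maybe ℕ
  D u = proj₁ (dom u)
  W : Fin n → Fin n → ℕ
  W u v = if lookup S v then scaledWt K (D u v) else 0
  B : ℕ
  B = 2 ^ suc K + K * (2 ^ K * 3) + n
  received : ∀ u → 2 ^ K ≤ ∑[ v < n ] W u v
  received u = 2^≤∑scaledWt S (D u) K (proj₂ (proj₂ (dom u)))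
  sent-from : ∀ v → ∑[ u < n ] W u v ≤ (if lookup S v then B else 0)
  sent-from v with lookup S v in v∈S
  ... | true  = ≤-trans (∑-mono-≤ (λ u → Frontier.scaledWt≤levelWeight G v K (D u v) (isDist u)))
                        (Frontier.∑-levelWeight G v Δ≤3 K)
    where
    isDist : ∀ u → IsDist G S u v (D u v)
    isDist u = proj₁ (proj₂ (dom u)) v (lookup⇒[]= v S v∈S)
  ... | false = ≤-reflexive (trans (∑-const n 0) (*-zeroʳ n))

2^-bracket : ∀ n → ∃[ K ] 2 ^ K ≤ n + 2 × n ≤ 2 ^ suc K
2^-bracket zero = 0 , s≤s z≤n , z≤n
2^-bracket (suc n) with 2^-bracket n
... | K , 2^K≤n+2 , n≤2^[1+K] with suc n ≤? 2 ^ suc K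
...   | yes 1+n≤2^[1+K] = K , m≤n⇒m≤1+n 2^K≤n+2 , 1+n≤2^[1+K]
...   | no  1+n≰2^[1+K] = suc K , ≤-trans 2^[1+K]≤n (≤-trans (n≤1+n n) (m≤m+n (suc n) 2)) ,
                          +-mono-≤ (m^n>0 2 (suc K)) (≤-trans n≤2^[1+K] (m≤m+n _ 0))
  where
  2^[1+K]≤n : 2 ^ suc K ≤ n
  2^[1+K]≤n = ≤-pred (≰⇒> 1+n≰2^[1+K])

counting⇒linear : ∀ {n s K} → n * 2 ^ K ≤ s * (2 ^ suc K + K * (2 ^ K * 3) + n) → n ≤ 2 ^ suc K →
                  n ≤ s * (3 * K + 4)
counting⇒linear {n} {s} {K} counted n≤2^[1+K] = *-cancelʳ-≤ n (s * (3 * K + 4)) (2 ^ K) {{m^n≢0 2 K}} (begin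
  n * 2 ^ K                                      ≤⟨ counted ⟩
  s * (2 ^ suc K + K * (2 ^ K * 3) + n)          ≤⟨ *-monoʳ-≤ s (+-monoʳ-≤ (2 ^ suc K + K * (2 ^ K * 3)) n≤2^[1+K]) ⟩
  s * (2 ^ suc K + K * (2 ^ K * 3) + 2 ^ suc K)  ≡⟨ rearrange s K (2 ^ K) ⟩
  s * (3 * K + 4) * 2 ^ K                        ∎)
  where
  open ≤-Reasoning
  rearrange : ∀ s K x → s * (2 * x + K * (x * 3) + 2 * x) ≡ s * (3 * K + 4) * x
  rearrange = solve-∀

linear⇒exponential : ∀ {n s K} → 2 ^ K ≤ n + 2 → n ≤ s * (3 * K + 4) → 2 ^ (n ∸ 4 * s) ≤ (n + 2) ^ (6 * s)
linear⇒exponential {n} {s} {K} 2^K≤n+2 n≤s[3K+4] = begin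
  2 ^ (n ∸ 4 * s)    ≤⟨ ^-monoʳ-≤ 2 exponent-bound ⟩
  2 ^ (K * (6 * s))  ≡⟨ ^-*-assoc 2 K (6 * s) ⟨
  (2 ^ K) ^ (6 * s)  ≤⟨ ^-monoˡ-≤ (6 * s) 2^K≤n+2 ⟩
  (n + 2) ^ (6 * s)  ∎
  where
  open ≤-Reasoning
  rearrange : ∀ s K → s * (3 * K + 4) ≡ K * (3 * s) + 4 * s
  rearrange = solve-∀
  exponent-bound : n ∸ 4 * s ≤ K * (6 * s)
  exponent-bound = begin
    n ∸ 4 * s                      ≤⟨ ∸-monoˡ-≤ (4 * s) n≤s[3K+4] ⟩
    s * (3 * K + 4) ∸ 4 * s        ≡⟨ cong (_∸ 4 * s) (rearrange s K) ⟩
    K * (3 * s) + 4 * s ∸ 4 * s    ≡⟨ m+n∸n≡m (K * (3 * s)) (4 * s) ⟩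
    K * (3 * s)                    ≤⟨ *-monoʳ-≤ K (*-monoˡ-≤ s (m≤m+n 3 3)) ⟩
    K * (6 * s)                    ∎

theorem4 : (n : ℕ) (G : Graph n) → MaxDegreeAtMost 3 G →
           (S : Subset n) → IsExpDominating G S →
           2 ^ (n ∸ 4 * ∣ S ∣) ≤ (n + 2) ^ (6 * ∣ S ∣)
theorem4 n G Δ≤3 S dom with 2^-bracket n
... | K , 2^K≤n+2 , n≤2^[1+K] =
  linear⇒exponential {n} {∣ S ∣} {K} 2^K≤n+2
    (counting⇒linear {n} {∣ S ∣} {K} (double-count G Δ≤3 S dom K) n≤2^[1+K])
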